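{- Let $p$ be a prime, $d$ a positive integer, $e_1,\ldots,e_d$ linearly independent vectors in $\mathbb{F}_p^d$, $\alpha_1,\ldots,\alpha_d\in\mathbb{F}_p$, and $A=\{e_1,\ldots,e_d,\alpha_1e_1+\cdots+\alpha_de_d\}$. Then $A$ is a nice basis of $\mathbb{F}_p^d$ (i.e. $hA=\mathbb{F}_p^d$ for some positive integer $h$) if and only if $\sum_{i=1}^d\alpha_i\not\equiv 1\pmod p$. If this condition holds, then $d(p-1)A=\mathbb{F}_p^d$ and $(d(p-1)-1)A\neq\mathbb{F}_p^d$.
   Context: For a positive integer $h$, $hA$ is the set of sums of $h$ not necessarily distinct elements of $A$, and $0A=\{0\}$. -}

module Defs where

open import Data.Nat using (ℕ; zero; suc; NonZero)
import Data.Nat as ℕ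
open import Data.Nat.DivMod using (_mod_)
open import Data.Fin using (Fin; toℕ) renaming (zero to fz; suc to fs)
open import Data.Product using (Σ; ∃; _×_)
open import Relation.Binary.PropositionalEquality using (_≡_)

module _ (p : ℕ) .{{_ : NonZero p}} where

  Fp : Set
  Fp = Fin p

  _+ₚ_ : Fp → Fp → Fp
  a +ₚ b = (toℕ a ℕ.+ toℕ b) mod p

  _*ₚ_ : Fp → Fp → Fp
  a *ₚ b = (toℕ a ℕ.* toℕ b) mod p

  0ₚ : Fp
  0ₚ = 0 mod p

  1ₚ : Fp
  1ₚ = 1 mod p

  sumₚ : (n : ℕ) → (Fin n → Fp) → Fp
  sumₚ zero    f = 0ₚ
  sumₚ (suc n) f = f fz +ₚ sumₚ n (λ i → f (fs i))

  Vect : ℕ → Set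
  Vect d = Fin d → Fp

  _≈_ : {d : ℕ} → Vect d → Vect d → Set
  x ≈ y = ∀ k → x k ≡ y k

  0ᵥ : {d : ℕ} → Vect d
  0ᵥ k = 0ₚ

  _+ᵥ_ : {d : ℕ} → Vect d → Vect d → Vect d
  (x +ᵥ y) k = x k +ₚ y k

  _·ᵥ_ : {d : ℕ} → Fp → Vect d → Vect d
  (c ·ᵥ x) k = c *ₚ x k

  sumᵥ : {d : ℕ} (n : ℕ) → (Fin n → Vect d) → Vect d
  sumᵥ zero    f = 0ᵥ
  sumᵥ (suc n) f = f fz +ᵥ sumᵥ n (λ i → f (fs i))

  linComb : {d n : ℕ} → (Fin n → Fp) → (Fin n → Vect d) → Vect d
  linComb {n = n} c v = sumᵥ n (λ i → c i ·ᵥ v i)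

  LinIndep : {d n : ℕ} → (Fin n → Vect d) → Set
  LinIndep {n = n} v = ∀ (c : Fin n → Fp) → linComb c v ≈ 0ᵥ → ∀ i → c i ≡ 0ₚ

  -- x ∈ hA, where A = {A i : i ∈ Fin m}: x is a sum of h (not necessarily
  -- distinct) elements of A. For h = 0 this is the empty sum 0, so 0A = {0}.
  InSumset : {d m : ℕ} → ℕ → (Fin m → Vect d) → Vect d → Set
  InSumset {m = m} h A x = Σ (Fin h → Fin m) λ f → sumᵥ h (λ j → A (f j)) ≈ x

  Covers : {d m : ℕ} → ℕ → (Fin m → Vect d) → Set
  Covers {d} h A = ∀ (x : Vect d) → InSumset h A x

  NiceBasis : {d m : ℕ} → (Fin m → Vect d) → Set
  NiceBasis A = ∃ λ h → 1 ℕ.≤ h × Covers h A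

  theSet : {d : ℕ} → (Fin d → Vect d) → (Fin d → Fp) → Fin (suc d) → Vect d
  theSet e α fz     = linComb α e
  theSet e α (fs i) = e i

module Submission where

-- A sum of h elements of A using v
-- n₀ times and eᵢ nᵢ times has coordinates n₀αᵢ + nᵢ, so (e being a basis)
-- hA = F_p^d says: every a ∈ F_p^d is (n₀αᵢ + nᵢ)ᵢ for some n with Σ n = h.
--  (I)   If S = 1 every element of A has coordinate sum 1, so no vector with
--        coordinate sum h + 1 lies in hA: A is not a nice basis.
--  (II)  If S ≠ 1, solve r (1 - S) = ⟦d(p-1)⟧ - Σ a and take n₀ ≡ r,
--        nᵢ ≡ aᵢ - r αᵢ; these residues sum to ⟦d(p-1)⟧ and lift to
--        multiplicities with total exactly d(p-1).
--  (III) If S ≠ 1, the vector (-1 - αᵢ)ᵢ forces every nᵢ ≡ -1, hence nᵢ ≥ p - 1,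
--        so it needs at least (d + 1)(p - 1) > d(p-1) - 1 elements.

open import Defs
open import Data.Nat as ℕ using (ℕ; zero; suc; NonZero; _≤_; _<_; _∸_; z≤n)
import Data.Nat.Properties as ℕₚ
open import Data.Nat.DivMod using (_mod_; _%_; %-distribˡ-+; %-distribˡ-*; m<n⇒m%n≡m; m%n<n; [m+kn]%n≡m%n)
open import Data.Nat.Divisibility using (_∣_; m%n≡0⇒n∣m; n∣m⇒m%n≡0; ∣⇒≤)
open import Data.Nat.Primality using (Prime; euclidsLemma; prime⇒nonTrivial)
open import Data.Fin using (Fin; toℕ; zero; suc; fromℕ<; punchOut; funToFin; finToFun; combine)
open import Data.Fin.Properties
  using (toℕ-fromℕ<; toℕ-injective; toℕ<n; toℕ≤pred[n]; any?; punchOut-injective; injective⇒≤;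
         funToFin-finToFin; finToFun-funToFin)
  renaming (_≟_ to _≟ᶠ_)
open import Data.Vec.Functional using (_∷_)
open import Data.Product using (_×_; _,_; ∃)
open import Data.Sum using (_⊎_; inj₁; inj₂; [_,_]′)
open import Relation.Nullary using (¬_; yes; no; contradiction)
open import Function.Base using (_∘_; id)
open import Function.Bundles using (_⇔_; mk⇔; Equivalence)
open import Relation.Binary.PropositionalEquality
open import Algebra.Bundles using (CommutativeRing)
import Algebra.Properties.CommutativeMonoid.Sum as MonoidSum
import Algebra.Properties.Semiring.Sum as SemiringSum
import Algebra.Properties.Group as GroupProperties
import Algebra.Properties.Ring as RingProperties

module ℕΣ = MonoidSum ℕₚ.+-0-commutativeMonoid
open ℕΣ using () renaming (sum to Σℕ)

Σℕ-mono : ∀ {n} {f g : Fin n → ℕ} → (∀ i → f i ≤ g i) → Σℕ f ≤ Σℕ g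
Σℕ-mono {zero}  f≤g = z≤n
Σℕ-mono {suc n} f≤g = ℕₚ.+-mono-≤ (f≤g zero) (Σℕ-mono (f≤g ∘ suc))

Σℕ-const : ∀ n c → Σℕ {n} (λ _ → c) ≡ n ℕ.* c
Σℕ-const zero    c = refl
Σℕ-const (suc n) c = cong (c ℕ.+_) (Σℕ-const n c)

injective⇒surjective : ∀ {n} (f : Fin n → Fin n) → (∀ {i j} → f i ≡ f j → i ≡ j) →
                       ∀ y → ∃ λ i → f i ≡ y
injective⇒surjective {suc n} f f-inj y with any? (λ i → f i ≟ᶠ y)
... | yes hit = hit
... | no miss = contradiction (injective⇒≤ g-inj) ℕₚ.1+n≰n
  where
  f≢y : ∀ i → y ≢ f i
  f≢y i y≡fi = miss (i , sym y≡fi)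

  -- f with the missed value y punched out: an injection Fin (suc n) → Fin n
  g : Fin (suc n) → Fin n
  g i = punchOut (f≢y i)

  g-inj : ∀ {i j} → g i ≡ g j → i ≡ j
  g-inj {i} {j} gi≡gj = f-inj (punchOut-injective (f≢y i) (f≢y j) gi≡gj)

funToFin-cong : ∀ {m n} {x y : Fin m → Fin n} → x ≗ y → funToFin x ≡ funToFin y
funToFin-cong {zero}  x≗y = refl
funToFin-cong {suc m} x≗y = cong₂ combine (x≗y zero) (funToFin-cong (x≗y ∘ suc))

funToFin-injective : ∀ {m n} {x y : Fin m → Fin n} → funToFin x ≡ funToFin y → x ≗ y
funToFin-injective {x = x} {y} eq k =
  trans (sym (finToFun-funToFin x k)) (trans (cong (λ i → finToFun i k) eq) (finToFun-funToFin y k))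

injective⇒surjectiveᶠ : ∀ {d n} (g : (Fin d → Fin n) → (Fin d → Fin n)) →
                        (∀ {x y} → g x ≗ g y → x ≗ y) → ∀ y → ∃ λ x → g x ≗ y
injective⇒surjectiveᶠ {d} {n} g g-inj y =
  let (i , Gi≡y) = injective⇒surjective G G-inj (funToFin y) in finToFun i , funToFin-injective Gi≡y
  where
  G : Fin (n ℕ.^ d) → Fin (n ℕ.^ d)
  G i = funToFin (g (finToFun i))

  G-inj : ∀ {i j} → G i ≡ G j → i ≡ j
  G-inj {i} {j} Gi≡Gj = trans (sym (funToFin-finToFin {d} {n} i))
    (trans (funToFin-cong (g-inj (funToFin-injective Gi≡Gj))) (funToFin-finToFin {d} {n} j))

module Residues (p : ℕ) .{{_ : NonZero p}} where

  infixl 6 _+_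
  infixl 7 _*_
  infix  8 -_

  _+_ _*_ : Fp p → Fp p → Fp p
  _+_ = _+ₚ_ p
  _*_ = _*ₚ_ p

  ⟦_⟧ : ℕ → Fp p
  ⟦ m ⟧ = m mod p

  -_ : Fp p → Fp p
  - a = ⟦ p ∸ toℕ a ⟧

  toℕ-⟦⟧ : ∀ m → toℕ ⟦ m ⟧ ≡ m % p
  toℕ-⟦⟧ m = toℕ-fromℕ< (m%n<n m p)

  ⟦⟧-cong-% : ∀ {m n} → m % p ≡ n % p → ⟦ m ⟧ ≡ ⟦ n ⟧
  ⟦⟧-cong-% {m} {n} eq = toℕ-injective (trans (toℕ-⟦⟧ m) (trans eq (sym (toℕ-⟦⟧ n))))

  ⟦toℕ⟧ : ∀ a → ⟦ toℕ a ⟧ ≡ a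
  ⟦toℕ⟧ a = toℕ-injective (trans (toℕ-⟦⟧ (toℕ a)) (m<n⇒m%n≡m (toℕ<n a)))

  ⟦⟧-+ : ∀ m n → ⟦ m ⟧ + ⟦ n ⟧ ≡ ⟦ m ℕ.+ n ⟧
  ⟦⟧-+ m n = ⟦⟧-cong-% (trans (cong₂ (λ x y → (x ℕ.+ y) % p) (toℕ-⟦⟧ m) (toℕ-⟦⟧ n))
                              (sym (%-distribˡ-+ m n p)))

  ⟦⟧-* : ∀ m n → ⟦ m ⟧ * ⟦ n ⟧ ≡ ⟦ m ℕ.* n ⟧
  ⟦⟧-* m n = ⟦⟧-cong-% (trans (cong₂ (λ x y → (x ℕ.* y) % p) (toℕ-⟦⟧ m) (toℕ-⟦⟧ n))
                              (sym (%-distribˡ-* m n p)))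

  ⟦p⟧≡0 : ⟦ p ⟧ ≡ ⟦ 0 ⟧
  ⟦p⟧≡0 = trans (cong ⟦_⟧ (sym (ℕₚ.+-identityʳ p))) (⟦⟧-cong-% ([m+kn]%n≡m%n 0 1 p))

  -- Every element is a residue, so an identity in Fin p may be checked on
  -- residues, where it follows from the corresponding identity in ℕ.
  residue-elim : {P : Fp p → Set} → (∀ m → P ⟦ m ⟧) → ∀ a → P a
  residue-elim {P} h a = subst P (⟦toℕ⟧ a) (h (toℕ a))

  by-ℕ : ∀ {x y : Fp p} {m n} → x ≡ ⟦ m ⟧ → m ≡ n → y ≡ ⟦ n ⟧ → x ≡ y
  by-ℕ x≡m m≡n y≡n = trans x≡m (trans (cong ⟦_⟧ m≡n) (sym y≡n))

  open import Algebra.Structures {A = Fp p} _≡_ using (IsCommutativeRing)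

  isCommutativeRing : IsCommutativeRing _+_ _*_ -_ ⟦ 0 ⟧ ⟦ 1 ⟧
  isCommutativeRing = record
    { isRing = record
      { +-isAbelianGroup = record
        { isGroup = record
          { isMonoid = record
            { isSemigroup = record
              { isMagma = record { isEquivalence = isEquivalence ; ∙-cong = cong₂ _+_ }
              ; assoc = residue-elim λ m → residue-elim λ n → residue-elim λ k →
                  by-ℕ (trans (cong (_+ ⟦ k ⟧) (⟦⟧-+ m n)) (⟦⟧-+ _ k)) (ℕₚ.+-assoc m n k)
                       (trans (cong (⟦ m ⟧ +_) (⟦⟧-+ n k)) (⟦⟧-+ m _))
              }
            ; identity = residue-elim (λ m → ⟦⟧-+ 0 m)
                       , residue-elim (λ m → by-ℕ (⟦⟧-+ m 0) (ℕₚ.+-identityʳ m) refl)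
            }
          ; inverse = -‿inverseˡ′ , λ a → trans (+-comm′ a (- a)) (-‿inverseˡ′ a)
          ; ⁻¹-cong = cong -_
          }
        ; comm = +-comm′
        }
      ; *-cong = cong₂ _*_
      ; *-assoc = residue-elim λ m → residue-elim λ n → residue-elim λ k →
          by-ℕ (trans (cong (_* ⟦ k ⟧) (⟦⟧-* m n)) (⟦⟧-* _ k)) (ℕₚ.*-assoc m n k)
               (trans (cong (⟦ m ⟧ *_) (⟦⟧-* n k)) (⟦⟧-* m _))
      ; *-identity = residue-elim (λ m → by-ℕ (⟦⟧-* 1 m) (ℕₚ.*-identityˡ m) refl)
                   , residue-elim (λ m → by-ℕ (⟦⟧-* m 1) (ℕₚ.*-identityʳ m) refl)
      ; distrib = (residue-elim λ m → residue-elim λ n → residue-elim λ k →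
                     by-ℕ (trans (cong (⟦ m ⟧ *_) (⟦⟧-+ n k)) (⟦⟧-* m _)) (ℕₚ.*-distribˡ-+ m n k)
                          (trans (cong₂ _+_ (⟦⟧-* m n) (⟦⟧-* m k)) (⟦⟧-+ _ _)))
                , (residue-elim λ m → residue-elim λ n → residue-elim λ k →
                     by-ℕ (trans (cong (_* ⟦ m ⟧) (⟦⟧-+ n k)) (⟦⟧-* _ m)) (ℕₚ.*-distribʳ-+ m n k)
                          (trans (cong₂ _+_ (⟦⟧-* n m) (⟦⟧-* k m)) (⟦⟧-+ _ _)))
      }
    ; *-comm = residue-elim λ m → residue-elim λ n → by-ℕ (⟦⟧-* m n) (ℕₚ.*-comm m n) (⟦⟧-* n m)
    }
    where
    +-comm′ : ∀ a b → a + b ≡ b + a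
    +-comm′ = residue-elim λ m → residue-elim λ n → by-ℕ (⟦⟧-+ m n) (ℕₚ.+-comm m n) (⟦⟧-+ n m)

    -‿inverseˡ′ : ∀ a → - a + a ≡ ⟦ 0 ⟧
    -‿inverseˡ′ a = begin
      - a + a                      ≡⟨ cong (- a +_) (⟦toℕ⟧ a) ⟨
      ⟦ p ∸ toℕ a ⟧ + ⟦ toℕ a ⟧     ≡⟨ ⟦⟧-+ (p ∸ toℕ a) (toℕ a) ⟩
      ⟦ p ∸ toℕ a ℕ.+ toℕ a ⟧       ≡⟨ cong ⟦_⟧ (ℕₚ.m∸n+n≡m (ℕₚ.<⇒≤ (toℕ<n a))) ⟩
      ⟦ p ⟧                        ≡⟨ ⟦p⟧≡0 ⟩
      ⟦ 0 ⟧                        ∎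
      where open ≡-Reasoning

  ring : CommutativeRing _ _
  ring = record { isCommutativeRing = isCommutativeRing }

  open CommutativeRing ring public
    using (0#; 1#; _-_; +-assoc; +-comm; +-identityˡ; +-identityʳ; -‿inverseˡ;
           *-comm; *-identityˡ; *-identityʳ; distribʳ; zeroˡ; zeroʳ; commutativeSemiring; semiring; +-group)
  open SemiringSum semiring public using (sum; sum-cong-≗; ∑-distrib-+; *-distribˡ-sum; sum-replicate-zero)
  open GroupProperties +-group public using (∙-cancelʳ; x∙y⁻¹≈ε⇒x≈y; x≈y⇒x∙y⁻¹≈ε; //-rightDividesˡ)
  open import Algebra.Solver.Ring.NaturalCoefficients.Default commutativeSemiring
    using (solve; _:=_; _:+_; _:*_; con)

  minus-plus : ∀ x y → x - y + y ≡ x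
  minus-plus x y = //-rightDividesˡ y x

  ⟦⟧-+-weights : ∀ m n x → ⟦ m ⟧ * x + ⟦ n ⟧ * x ≡ ⟦ m ℕ.+ n ⟧ * x
  ⟦⟧-+-weights m n x = trans (sym (distribʳ x ⟦ m ⟧ ⟦ n ⟧)) (cong (_* x) (⟦⟧-+ m n))

  sumₚ≡sum : ∀ n (f : Fin n → Fp p) → sumₚ p n f ≡ sum f
  sumₚ≡sum zero    f = refl
  sumₚ≡sum (suc n) f = cong (f zero +_) (sumₚ≡sum n (f ∘ suc))

  sum-const : ∀ n x → sum {n} (λ _ → x) ≡ ⟦ n ⟧ * x
  sum-const zero    x = sym (zeroˡ x)
  sum-const (suc n) x = begin
    x + sum {n} (λ _ → x)    ≡⟨ cong (x +_) (sum-const n x) ⟩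
    x + ⟦ n ⟧ * x            ≡⟨ solve 2 (λ x n → x :+ n :* x := (con 1 :+ n) :* x) refl x ⟦ n ⟧ ⟩
    (⟦ 1 ⟧ + ⟦ n ⟧) * x      ≡⟨ cong (_* x) (⟦⟧-+ 1 n) ⟩
    ⟦ suc n ⟧ * x            ∎
    where open ≡-Reasoning

  ⟦⟧-Σ : ∀ {n} (f : Fin n → ℕ) → ⟦ Σℕ f ⟧ ≡ sum (⟦_⟧ ∘ f)
  ⟦⟧-Σ {zero}  f = refl
  ⟦⟧-Σ {suc n} f = trans (sym (⟦⟧-+ (f zero) _)) (cong (⟦ f zero ⟧ +_) (⟦⟧-Σ (f ∘ suc)))

  sumᵥ-at : ∀ {d} n (g : Fin n → Vect p d) k → sumᵥ p n g k ≡ sum (λ j → g j k)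
  sumᵥ-at zero    g k = refl
  sumᵥ-at (suc n) g k = cong (g zero k +_) (sumᵥ-at n (g ∘ suc) k)

  linComb-at : ∀ {d n} (c : Fin n → Fp p) (v : Fin n → Vect p d) k →
               linComb p c v k ≡ sum (λ i → c i * v i k)
  linComb-at {n = n} c v = sumᵥ-at n (λ i → _·ᵥ_ p (c i) (v i))

  toℕ-0 : toℕ ⟦ 0 ⟧ ≡ 0
  toℕ-0 = trans (toℕ-⟦⟧ 0) (m<n⇒m%n≡m (ℕ.>-nonZero⁻¹ p))

  ⟦⟧≡0⇒∣ : ∀ m → ⟦ m ⟧ ≡ 0# → p ∣ m
  ⟦⟧≡0⇒∣ m ⟦m⟧≡0 = m%n≡0⇒n∣m m p (trans (sym (toℕ-⟦⟧ m)) (trans (cong toℕ ⟦m⟧≡0) toℕ-0))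

  ∣⇒⟦⟧≡0 : ∀ m → p ∣ m → ⟦ m ⟧ ≡ 0#
  ∣⇒⟦⟧≡0 m p∣m = toℕ-injective (trans (toℕ-⟦⟧ m) (trans (n∣m⇒m%n≡0 m p p∣m) (sym toℕ-0)))

  ⟦⟧-≤ : ∀ {m n} → ⟦ m ⟧ ≡ ⟦ n ⟧ → m < n ℕ.+ p → m ≤ n
  ⟦⟧-≤ {m} {n} ⟦m⟧≡⟦n⟧ m<n+p with m ℕ.≤? n
  ... | yes m≤n = m≤n
  ... | no m≰n = contradiction m<n+p (ℕₚ.≤⇒≯ n+p≤m)
    where
    n<m = ℕₚ.≰⇒> m≰n
    δ = m ∸ n
    δ+n≡m : δ ℕ.+ n ≡ m
    δ+n≡m = ℕₚ.m∸n+n≡m (ℕₚ.<⇒≤ n<m)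
    ⟦δ⟧≡0 : ⟦ δ ⟧ ≡ 0#
    ⟦δ⟧≡0 = ∙-cancelʳ ⟦ n ⟧ ⟦ δ ⟧ 0#
      (trans (⟦⟧-+ δ n) (trans (cong ⟦_⟧ δ+n≡m) (trans ⟦m⟧≡⟦n⟧ (sym (+-identityˡ ⟦ n ⟧)))))
    instance
      δ≢0 : NonZero δ
      δ≢0 = ℕ.>-nonZero (ℕₚ.m<n⇒0<n∸m n<m)
    n+p≤m : n ℕ.+ p ≤ m
    n+p≤m = ℕₚ.≤-trans (ℕₚ.+-monoʳ-≤ n (∣⇒≤ (⟦⟧≡0⇒∣ δ ⟦δ⟧≡0)))
                       (ℕₚ.≤-reflexive (trans (ℕₚ.+-comm n δ) δ+n≡m))

  ⟦⟧+1≡0⇒≥ : ∀ m → ⟦ m ⟧ + 1# ≡ 0# → p ∸ 1 ≤ m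
  ⟦⟧+1≡0⇒≥ m ⟦m⟧+1≡0 = ℕₚ.pred-mono-≤ (∣⇒≤ (⟦⟧≡0⇒∣ (suc m) ⟦1+m⟧≡0))
    where
    ⟦1+m⟧≡0 : ⟦ suc m ⟧ ≡ 0#
    ⟦1+m⟧≡0 = trans (sym (⟦⟧-+ 1 m)) (trans (+-comm ⟦ 1 ⟧ ⟦ m ⟧) ⟦m⟧+1≡0)

  -- Residues x₀, …, x_k with sum ⟦ H ⟧ are the residues of naturals with sum
  -- exactly H, provided k (p - 1) ≤ H: the canonical representatives sum to at
  -- most H + (p - 1), hence (being congruent to H) to at most H, and the
  -- shortfall, a multiple of p, is added to the first one.
  lift-residues : ∀ {k} H (x : Fin (suc k) → Fp p) → sum x ≡ ⟦ H ⟧ → k ℕ.* (p ∸ 1) ≤ H →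
                  ∃ λ n → Σℕ n ≡ H × (∀ j → ⟦ n j ⟧ ≡ x j)
  lift-residues {k} H x Σx≡H k[p-1]≤H = n , total , n≡x
    where
    T = Σℕ (toℕ ∘ x)

    ⟦T⟧≡⟦H⟧ : ⟦ T ⟧ ≡ ⟦ H ⟧
    ⟦T⟧≡⟦H⟧ = trans (⟦⟧-Σ (toℕ ∘ x)) (trans (sum-cong-≗ (⟦toℕ⟧ ∘ x)) Σx≡H)

    T<H+p : T < H ℕ.+ p
    T<H+p = begin-strict
      T                            ≤⟨ Σℕ-mono (toℕ≤pred[n] ∘ x) ⟩
      Σℕ {suc k} (λ _ → p ∸ 1)     ≡⟨ Σℕ-const (suc k) (p ∸ 1) ⟩
      p ∸ 1 ℕ.+ k ℕ.* (p ∸ 1)      ≤⟨ ℕₚ.+-monoʳ-≤ (p ∸ 1) k[p-1]≤H ⟩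
      p ∸ 1 ℕ.+ H                  <⟨ ℕₚ.+-monoˡ-< H (ℕₚ.≤-reflexive (ℕₚ.suc-pred p)) ⟩
      p ℕ.+ H                      ≡⟨ ℕₚ.+-comm p H ⟩
      H ℕ.+ p                      ∎
      where open ℕₚ.≤-Reasoning

    T≤H : T ≤ H
    T≤H = ⟦⟧-≤ ⟦T⟧≡⟦H⟧ T<H+p

    D = H ∸ T

    D+T≡H : D ℕ.+ T ≡ H
    D+T≡H = ℕₚ.m∸n+n≡m T≤H

    ⟦D⟧≡0 : ⟦ D ⟧ ≡ 0#
    ⟦D⟧≡0 = ∙-cancelʳ ⟦ T ⟧ ⟦ D ⟧ 0#
      (trans (⟦⟧-+ D T) (trans (cong ⟦_⟧ D+T≡H) (trans (sym ⟦T⟧≡⟦H⟧) (sym (+-identityˡ ⟦ T ⟧)))))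

    n : Fin (suc k) → ℕ
    n zero    = D ℕ.+ toℕ (x zero)
    n (suc j) = toℕ (x (suc j))

    total : Σℕ n ≡ H
    total = trans (ℕₚ.+-assoc D (toℕ (x zero)) _) D+T≡H

    n≡x : ∀ j → ⟦ n j ⟧ ≡ x j
    n≡x zero    = begin
      ⟦ D ℕ.+ toℕ (x zero) ⟧      ≡⟨ ⟦⟧-+ D (toℕ (x zero)) ⟨
      ⟦ D ⟧ + ⟦ toℕ (x zero) ⟧    ≡⟨ cong₂ _+_ ⟦D⟧≡0 (⟦toℕ⟧ (x zero)) ⟩
      0# + x zero                 ≡⟨ +-identityˡ (x zero) ⟩
      x zero                      ∎
      where open ≡-Reasoning
    n≡x (suc j) = ⟦toℕ⟧ (x (suc j))

  -- A linearly independent family determines the coefficients of its linear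
  -- combinations: apply independence to the difference of two coefficient vectors.
  linComb-injective : ∀ {d n} {v : Fin n → Vect p d} → LinIndep p v →
                      ∀ {c c′} → linComb p c v ≗ linComb p c′ v → c ≗ c′
  linComb-injective {v = v} indep {c} {c′} cv≗c′v i =
    x∙y⁻¹≈ε⇒x≈y (c i) (c′ i) (indep (λ j → c j - c′ j) difference-vanishes i)
    where
    difference-vanishes : ∀ k → linComb p (λ j → c j - c′ j) v k ≡ 0#
    difference-vanishes k = trans (linComb-at (λ j → c j - c′ j) v k) (∙-cancelʳ C′ D 0# (begin
      D + C′
        ≡⟨ ∑-distrib-+ (λ j → (c j - c′ j) * v j k) (λ j → c′ j * v j k) ⟨
      sum (λ j → (c j - c′ j) * v j k + c′ j * v j k)
        ≡⟨ sum-cong-≗ (λ j → distribʳ (v j k) (c j - c′ j) (c′ j)) ⟨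
      sum (λ j → (c j - c′ j + c′ j) * v j k)
        ≡⟨ sum-cong-≗ (λ j → cong (_* v j k) (minus-plus (c j) (c′ j))) ⟩
      sum (λ j → c j * v j k)
        ≡⟨ linComb-at c v k ⟨
      linComb p c v k
        ≡⟨ cv≗c′v k ⟩
      linComb p c′ v k
        ≡⟨ linComb-at c′ v k ⟩
      C′
        ≡⟨ +-identityˡ C′ ⟨
      0# + C′
        ∎))
      where
      open ≡-Reasoning
      D  = sum (λ j → (c j - c′ j) * v j k)
      C′ = sum (λ j → c′ j * v j k)

  -- d linearly independent vectors span F_p^d: linear combination with them is
  -- an injective, hence surjective, map of the finite set F_p^d to itself.
  linComb-surjective : ∀ {d} {v : Fin d → Vect p d} → LinIndep p v →
                       ∀ x → ∃ λ c → linComb p c v ≗ x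
  linComb-surjective {v = v} indep = injective⇒surjectiveᶠ (λ c → linComb p c v) (linComb-injective indep)

  linComb-cong : ∀ {d n} {c c′ : Fin n → Fp p} (v : Fin n → Vect p d) → c ≗ c′ → linComb p c v ≗ linComb p c′ v
  linComb-cong {c = c} {c′} v c≗c′ k =
    trans (linComb-at c v k) (trans (sum-cong-≗ (λ i → cong (_* v i k) (c≗c′ i))) (sym (linComb-at c′ v k)))

  δ : ∀ {m} → Fin m → Fin m → ℕ
  δ zero    zero    = 1
  δ zero    (suc _) = 0
  δ (suc _) zero    = 0
  δ (suc a) (suc b) = δ a b

  Σℕ-δ : ∀ {m} (a : Fin m) → Σℕ (δ a) ≡ 1
  Σℕ-δ {suc m} zero    = cong (1 ℕ.+_) (ℕΣ.sum-replicate-zero m)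
  Σℕ-δ {suc m} (suc a) = Σℕ-δ a

  sum-δ : ∀ {m} (a : Fin m) (g : Fin m → Fp p) → sum (λ b → ⟦ δ a b ⟧ * g b) ≡ g a
  sum-δ {suc m} zero    g = trans (cong₂ _+_ (*-identityˡ (g zero))
                                             (trans (sum-cong-≗ (zeroˡ ∘ g ∘ suc)) (sum-replicate-zero m)))
                                  (+-identityʳ (g zero))
  sum-δ {suc m} (suc a) g = trans (cong₂ _+_ (zeroˡ (g zero)) (sum-δ a (g ∘ suc))) (+-identityˡ (g (suc a)))

  -- A list f : Fin h → Fin m has multiplicities n : Fin m → ℕ when every sum of
  -- F_p-values along the list may be computed by weighting with n.
  HasMultiplicities : ∀ {h m} → (Fin h → Fin m) → (Fin m → ℕ) → Set
  HasMultiplicities f n = ∀ g → sum (g ∘ f) ≡ sum (λ b → ⟦ n b ⟧ * g b)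

  count : ∀ {h m} → (Fin h → Fin m) → Fin m → ℕ
  count {zero}  f b = 0
  count {suc h} f b = δ (f zero) b ℕ.+ count (f ∘ suc) b

  count-total : ∀ {h m} (f : Fin h → Fin m) → Σℕ (count f) ≡ h
  count-total {zero}  {m} f = ℕΣ.sum-replicate-zero m
  count-total {suc h}     f = trans (ℕΣ.∑-distrib-+ (δ (f zero)) (count (f ∘ suc)))
                                    (cong₂ ℕ._+_ (Σℕ-δ (f zero)) (count-total (f ∘ suc)))

  count-multiplicities : ∀ {h m} (f : Fin h → Fin m) → HasMultiplicities f (count f)
  count-multiplicities {zero}  {m} f g = sym (trans (sum-cong-≗ (zeroˡ ∘ g)) (sum-replicate-zero m))
  count-multiplicities {suc h}     f g = begin
    g (f zero) + sum (g ∘ f ∘ suc)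
      ≡⟨ cong₂ _+_ (sum-δ (f zero) g) (sym (count-multiplicities (f ∘ suc) g)) ⟨
    sum (λ b → ⟦ δ (f zero) b ⟧ * g b) + sum (λ b → ⟦ count (f ∘ suc) b ⟧ * g b)
      ≡⟨ ∑-distrib-+ (λ b → ⟦ δ (f zero) b ⟧ * g b) (λ b → ⟦ count (f ∘ suc) b ⟧ * g b) ⟨
    sum (λ b → ⟦ δ (f zero) b ⟧ * g b + ⟦ count (f ∘ suc) b ⟧ * g b)
      ≡⟨ sum-cong-≗ (λ b → ⟦⟧-+-weights (δ (f zero) b) (count (f ∘ suc) b) (g b)) ⟩
    sum (λ b → ⟦ count f b ⟧ * g b)
      ∎
    where open ≡-Reasoning

  prepend : ∀ {h m} → Fin m → (c : ℕ) → (Fin h → Fin m) → Fin (c ℕ.+ h) → Fin m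
  prepend a zero    f = f
  prepend a (suc c) f = a ∷ prepend a c f

  sum-prepend : ∀ {h m} (a : Fin m) c (f : Fin h → Fin m) g →
                sum (g ∘ prepend a c f) ≡ ⟦ c ⟧ * g a + sum (g ∘ f)
  sum-prepend a zero    f g = sym (trans (cong (_+ sum (g ∘ f)) (zeroˡ (g a))) (+-identityˡ _))
  sum-prepend a (suc c) f g = begin
    g a + sum (g ∘ prepend a c f)       ≡⟨ cong (g a +_) (sum-prepend a c f g) ⟩
    g a + (⟦ c ⟧ * g a + sum (g ∘ f))   ≡⟨ solve 3 (λ x c s → x :+ (c :* x :+ s) := (con 1 :+ c) :* x :+ s)
                                                   refl (g a) ⟦ c ⟧ (sum (g ∘ f)) ⟩
    (⟦ 1 ⟧ + ⟦ c ⟧) * g a + sum (g ∘ f)  ≡⟨ cong (λ y → y * g a + sum (g ∘ f)) (⟦⟧-+ 1 c) ⟩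
    ⟦ suc c ⟧ * g a + sum (g ∘ f)       ∎
    where open ≡-Reasoning

  fromCounts : ∀ {m} (n : Fin m → ℕ) → Fin (Σℕ n) → Fin m
  fromCounts {zero}  n ()
  fromCounts {suc m} n = prepend zero (n zero) (suc ∘ fromCounts (n ∘ suc))

  fromCounts-multiplicities : ∀ {m} (n : Fin m → ℕ) → HasMultiplicities (fromCounts n) n
  fromCounts-multiplicities {zero}  n g = refl
  fromCounts-multiplicities {suc m} n g =
    trans (sum-prepend zero (n zero) (suc ∘ fromCounts (n ∘ suc)) g)
          (cong (⟦ n zero ⟧ * g zero +_) (fromCounts-multiplicities (n ∘ suc) (g ∘ suc)))


module Field (p : ℕ) .{{_ : NonZero p}} (isPrime : Prime p) where

  open Residues p
  open RingProperties (CommutativeRing.ring ring) using (x[y-z]≈xy-xz)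

  1<p : 1 < p
  1<p = ℕ.nonTrivial⇒n>1 p {{prime⇒nonTrivial isPrime}}

  1≤p-1 : 1 ≤ p ∸ 1
  1≤p-1 = ℕₚ.<⇒≤pred 1<p

  1≤d[p-1] : ∀ {d} → 1 ≤ d → 1 ≤ d ℕ.* (p ∸ 1)
  1≤d[p-1] 1≤d = ℕₚ.*-mono-≤ 1≤d 1≤p-1

  ⟦1+h⟧≢⟦h⟧ : ∀ h → ⟦ suc h ⟧ ≢ ⟦ h ⟧
  ⟦1+h⟧≢⟦h⟧ h eq = ℕₚ.1+n≰n (⟦⟧-≤ eq 2+h≤h+p)
    where
    2+h≤h+p : suc (suc h) ≤ h ℕ.+ p
    2+h≤h+p = ℕₚ.≤-trans (ℕₚ.+-monoˡ-≤ h 1<p) (ℕₚ.≤-reflexive (ℕₚ.+-comm p h))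

  no-zero-divisors : ∀ x y → x * y ≡ 0# → x ≡ 0# ⊎ y ≡ 0#
  no-zero-divisors x y xy≡0 with euclidsLemma (toℕ x) (toℕ y) isPrime (⟦⟧≡0⇒∣ _ xy≡0)
  ... | inj₁ p∣x = inj₁ (trans (sym (⟦toℕ⟧ x)) (∣⇒⟦⟧≡0 (toℕ x) p∣x))
  ... | inj₂ p∣y = inj₂ (trans (sym (⟦toℕ⟧ y)) (∣⇒⟦⟧≡0 (toℕ y) p∣y))

  *-cancelˡ-⊎ : ∀ w s t → w * s ≡ w * t → w ≡ 0# ⊎ s ≡ t
  *-cancelˡ-⊎ w s t ws≡wt with no-zero-divisors w (s - t) (trans (x[y-z]≈xy-xz w s t) (x≈y⇒x∙y⁻¹≈ε ws≡wt))
  ... | inj₁ w≡0   = inj₁ w≡0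
  ... | inj₂ s-t≡0 = inj₂ (x∙y⁻¹≈ε⇒x≈y s t s-t≡0)

  -- division by a non-zero element: r ↦ r u is injective, hence surjective
  division : ∀ u → u ≢ 0# → ∀ t → ∃ λ r → r * u ≡ t
  division u u≢0 = injective⇒surjective (_* u) cancel
    where
    cancel : ∀ {r r′} → r * u ≡ r′ * u → r ≡ r′
    cancel {r} {r′} ru≡r′u with *-cancelˡ-⊎ u r r′ (trans (*-comm u r) (trans ru≡r′u (*-comm r′ u)))
    ... | inj₁ u≡0  = contradiction u≡0 u≢0
    ... | inj₂ r≡r′ = r≡r′

-- Multisets drawn from A = {v, e₁, …, e_d}, v = α₁e₁ + ⋯ + α_d e_d, described
-- by their multiplicities n : Fin (suc d) → ℕ (n zero for v, n (suc i) for eᵢ)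
-- and their coordinates with respect to e₁, …, e_d.
module Multisets (p : ℕ) .{{_ : NonZero p}} {d : ℕ} (α : Fin d → Fp p) where

  open Residues p
  open import Algebra.Solver.Ring.NaturalCoefficients.Default commutativeSemiring
    using (solve; _:=_; _:+_; _:*_; con)

  S : Fp p
  S = sum α

  coords : (Fin (suc d) → ℕ) → Fin d → Fp p
  coords n i = ⟦ n zero ⟧ * α i + ⟦ n (suc i) ⟧

  Representable : ℕ → (Fin d → Fp p) → Set
  Representable h a = ∃ λ n → Σℕ n ≡ h × (∀ i → coords n i ≡ a i)

  coordinate-sum : ∀ n → sum (coords n) ≡ ⟦ n zero ⟧ * S + ⟦ Σℕ (n ∘ suc) ⟧
  coordinate-sum n = begin
    sum (λ i → ⟦ n zero ⟧ * α i + ⟦ n (suc i) ⟧)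
      ≡⟨ ∑-distrib-+ (λ i → ⟦ n zero ⟧ * α i) (⟦_⟧ ∘ n ∘ suc) ⟩
    sum (λ i → ⟦ n zero ⟧ * α i) + sum (⟦_⟧ ∘ n ∘ suc)
      ≡⟨ cong₂ _+_ (*-distribˡ-sum ⟦ n zero ⟧ α) (⟦⟧-Σ (n ∘ suc)) ⟨
    ⟦ n zero ⟧ * S + ⟦ Σℕ (n ∘ suc) ⟧
      ∎
    where open ≡-Reasoning

  -- (I) If S = 1 every element of A has coordinate sum 1, so a sum of h
  -- elements has coordinate sum h.
  coordinate-sum-if-S≡1 : S ≡ 1# → ∀ {h a} → Representable h a → sum a ≡ ⟦ h ⟧
  coordinate-sum-if-S≡1 S≡1 {h} {a} (n , Σn≡h , coords≡a) = begin
    sum a                                   ≡⟨ sum-cong-≗ coords≡a ⟨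
    sum (coords n)                          ≡⟨ coordinate-sum n ⟩
    ⟦ n zero ⟧ * S + ⟦ Σℕ (n ∘ suc) ⟧       ≡⟨ cong (λ s → ⟦ n zero ⟧ * s + ⟦ Σℕ (n ∘ suc) ⟧) S≡1 ⟩
    ⟦ n zero ⟧ * 1# + ⟦ Σℕ (n ∘ suc) ⟧      ≡⟨ cong (_+ ⟦ Σℕ (n ∘ suc) ⟧) (*-identityʳ ⟦ n zero ⟧) ⟩
    ⟦ n zero ⟧ + ⟦ Σℕ (n ∘ suc) ⟧           ≡⟨ ⟦⟧-+ (n zero) (Σℕ (n ∘ suc)) ⟩
    ⟦ Σℕ n ⟧                                ≡⟨ cong ⟦_⟧ Σn≡h ⟩
    ⟦ h ⟧                                   ∎
    where open ≡-Reasoning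

  module _ (isPrime : Prime p) where
    open Field p isPrime

    -- hence, if S = 1, a vector with coordinate sum ⟦ 1 + h ⟧ is not a sum of h elements
    unrepresentable-if-S≡1 : S ≡ 1# → 1 ≤ d → ∀ h → ∃ λ a → ¬ Representable h a
    unrepresentable-if-S≡1 S≡1 1≤d h = a , λ representable →
      ⟦1+h⟧≢⟦h⟧ h (trans (sym Σa≡⟦1+h⟧) (coordinate-sum-if-S≡1 S≡1 representable))
      where
      i₀ = fromℕ< 1≤d
      a : Fin d → Fp p
      a i = ⟦ δ i₀ i ⟧ * ⟦ suc h ⟧
      Σa≡⟦1+h⟧ : sum a ≡ ⟦ suc h ⟧
      Σa≡⟦1+h⟧ = sum-δ i₀ (λ _ → ⟦ suc h ⟧)

    -- (II) If S ≠ 1, every vector a is the coordinate vector of a sum of exactly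
    -- H = d (p - 1) elements of A: take v with multiplicity r, where
    -- r (1 - S) = ⟦ H ⟧ - Σ a, and eᵢ with multiplicity aᵢ - r αᵢ; these residues
    -- sum to ⟦ H ⟧, so they lift to multiplicities summing to H.
    representable-if-S≢1 : S ≢ 1# → ∀ a → Representable (d ℕ.* (p ∸ 1)) a
    representable-if-S≢1 S≢1 a = from-quotient (division (1# - S) 1-S≢0 (⟦ H ⟧ - sum a))
      where
      open ≡-Reasoning
      H = d ℕ.* (p ∸ 1)

      1-S≢0 : 1# - S ≢ 0#
      1-S≢0 1-S≡0 = S≢1 (sym (x∙y⁻¹≈ε⇒x≈y 1# S 1-S≡0))

      distribute : ∀ r u s t → r * (u + s) + t ≡ r * u + t + r * s
      distribute = solve 4 (λ r u s t → r :* (u :+ s) :+ t := r :* u :+ t :+ r :* s) refl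

      from-quotient : (∃ λ r → r * (1# - S) ≡ ⟦ H ⟧ - sum a) → Representable H a
      from-quotient (r , r[1-S]≡H-Σa) = from-lift (lift-residues H (r ∷ m) Σr∷m≡H ℕₚ.≤-refl)
        where
        m : Fin d → Fp p
        m i = a i - r * α i

        Σm+rS≡Σa : sum m + r * S ≡ sum a
        Σm+rS≡Σa = begin
          sum m + r * S                ≡⟨ cong (sum m +_) (*-distribˡ-sum r α) ⟩
          sum m + sum (λ i → r * α i)  ≡⟨ ∑-distrib-+ m (λ i → r * α i) ⟨
          sum (λ i → m i + r * α i)    ≡⟨ sum-cong-≗ (λ i → minus-plus (a i) (r * α i)) ⟩
          sum a                        ∎

        Σr∷m≡H : sum (r ∷ m) ≡ ⟦ H ⟧
        Σr∷m≡H = ∙-cancelʳ (r * S) (r + sum m) ⟦ H ⟧ (begin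
          r + sum m + r * S             ≡⟨ +-assoc r (sum m) (r * S) ⟩
          r + (sum m + r * S)           ≡⟨ cong (r +_) Σm+rS≡Σa ⟩
          r + sum a                     ≡⟨ cong (_+ sum a) (*-identityʳ r) ⟨
          r * 1# + sum a                ≡⟨ cong (λ y → r * y + sum a) (minus-plus 1# S) ⟨
          r * (1# - S + S) + sum a      ≡⟨ distribute r (1# - S) S (sum a) ⟩
          r * (1# - S) + sum a + r * S  ≡⟨ cong (λ y → y + sum a + r * S) r[1-S]≡H-Σa ⟩
          ⟦ H ⟧ - sum a + sum a + r * S ≡⟨ cong (_+ r * S) (minus-plus ⟦ H ⟧ (sum a)) ⟩
          ⟦ H ⟧ + r * S                 ∎)

        from-lift : (∃ λ n → Σℕ n ≡ H × (∀ j → ⟦ n j ⟧ ≡ (r ∷ m) j)) → Representable H a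
        from-lift (n , Σn≡H , ⟦n⟧≡r∷m) = n , Σn≡H , λ i → begin
          ⟦ n zero ⟧ * α i + ⟦ n (suc i) ⟧  ≡⟨ cong₂ (λ y z → y * α i + z) (⟦n⟧≡r∷m zero) (⟦n⟧≡r∷m (suc i)) ⟩
          r * α i + (a i - r * α i)         ≡⟨ +-comm (r * α i) (a i - r * α i) ⟩
          a i - r * α i + r * α i           ≡⟨ minus-plus (a i) (r * α i) ⟩
          a i                               ∎

    ⟦H⟧+⟦d⟧≡0 : ⟦ d ℕ.* (p ∸ 1) ⟧ + ⟦ d ⟧ ≡ 0#
    ⟦H⟧+⟦d⟧≡0 = begin
      ⟦ d ℕ.* (p ∸ 1) ⟧ + ⟦ d ⟧    ≡⟨ ⟦⟧-+ (d ℕ.* (p ∸ 1)) d ⟩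
      ⟦ d ℕ.* (p ∸ 1) ℕ.+ d ⟧      ≡⟨ cong ⟦_⟧ H+d≡dp ⟩
      ⟦ d ℕ.* p ⟧                  ≡⟨ ⟦⟧-* d p ⟨
      ⟦ d ⟧ * ⟦ p ⟧                ≡⟨ cong (⟦ d ⟧ *_) ⟦p⟧≡0 ⟩
      ⟦ d ⟧ * 0#                   ≡⟨ zeroʳ ⟦ d ⟧ ⟩
      0#                           ∎
      where
      open ≡-Reasoning
      H+d≡dp : d ℕ.* (p ∸ 1) ℕ.+ d ≡ d ℕ.* p
      H+d≡dp = trans (ℕₚ.+-comm _ d) (trans (sym (ℕₚ.*-suc d (p ∸ 1))) (cong (d ℕ.*_) (ℕₚ.suc-pred p)))

    -- Summing the coordinates and counting
    -- the elements give (x + 1) S = x + 1 for the multiplicity x of v, so x ≡ -1,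
    -- and then each eᵢ has multiplicity ≡ -1 too.
    minus-one-multiplicities : S ≢ 1# → 1 ≤ d → ∀ n → Σℕ n ≡ d ℕ.* (p ∸ 1) ∸ 1 →
                               (∀ i → coords n i ≡ - (1# + α i)) → ∀ k → ⟦ n k ⟧ + 1# ≡ 0#
    minus-one-multiplicities S≢1 1≤d n Σn≡H-1 coords≡a = ⟦n⟧+1≡0
      where
      open ≡-Reasoning
      H = d ℕ.* (p ∸ 1)
      x = ⟦ n zero ⟧
      c = ⟦ Σℕ (n ∘ suc) ⟧

      vanish : ∀ i → coords n i + (1# + α i) ≡ 0#
      vanish i = trans (cong (_+ (1# + α i)) (coords≡a i)) (-‿inverseˡ (1# + α i))

      coordinates : x * S + c + (⟦ d ⟧ + S) ≡ 0#
      coordinates = begin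
        x * S + c + (⟦ d ⟧ + S)
          ≡⟨ cong₂ _+_ (coordinate-sum n) (cong (_+ S) (trans (sum-const d 1#) (*-identityʳ ⟦ d ⟧))) ⟨
        sum (coords n) + (sum {d} (λ _ → 1#) + S)
          ≡⟨ cong (sum (coords n) +_) (∑-distrib-+ (λ _ → 1#) α) ⟨
        sum (coords n) + sum (λ i → 1# + α i)
          ≡⟨ ∑-distrib-+ (coords n) (λ i → 1# + α i) ⟨
        sum (λ i → coords n i + (1# + α i))
          ≡⟨ sum-cong-≗ vanish ⟩
        sum {d} (λ _ → 0#)
          ≡⟨ sum-replicate-zero d ⟩
        0#
          ∎

      size : x + c + 1# + ⟦ d ⟧ ≡ 0#
      size = begin
        x + c + 1# + ⟦ d ⟧
          ≡⟨ cong (λ y → y + 1# + ⟦ d ⟧) (trans (⟦⟧-+ (n zero) (Σℕ (n ∘ suc))) (cong ⟦_⟧ Σn≡H-1)) ⟩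
        ⟦ H ∸ 1 ⟧ + ⟦ 1 ⟧ + ⟦ d ⟧
          ≡⟨ cong (_+ ⟦ d ⟧) (trans (⟦⟧-+ (H ∸ 1) 1) (cong ⟦_⟧ (ℕₚ.m∸n+n≡m (1≤d[p-1] 1≤d)))) ⟩
        ⟦ H ⟧ + ⟦ d ⟧
          ≡⟨ ⟦H⟧+⟦d⟧≡0 ⟩
        0#
          ∎

      [x+1]S≡[x+1]1 : (x + 1#) * S ≡ (x + 1#) * 1#
      [x+1]S≡[x+1]1 = ∙-cancelʳ (c + ⟦ d ⟧) ((x + 1#) * S) ((x + 1#) * 1#) (begin
        (x + 1#) * S + (c + ⟦ d ⟧)
          ≡⟨ solve 4 (λ x s c d → (x :+ con 1) :* s :+ (c :+ d) := x :* s :+ c :+ (d :+ s)) refl x S c ⟦ d ⟧ ⟩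
        x * S + c + (⟦ d ⟧ + S)
          ≡⟨ trans coordinates (sym size) ⟩
        x + c + 1# + ⟦ d ⟧
          ≡⟨ solve 3 (λ x c d → x :+ c :+ con 1 :+ d := (x :+ con 1) :* con 1 :+ (c :+ d)) refl x c ⟦ d ⟧ ⟩
        (x + 1#) * 1# + (c + ⟦ d ⟧)
          ∎)

      x+1≡0 : x + 1# ≡ 0#
      x+1≡0 = [ id , (λ S≡1 → contradiction S≡1 S≢1) ]′ (*-cancelˡ-⊎ (x + 1#) S 1# [x+1]S≡[x+1]1)

      ⟦n⟧+1≡0 : ∀ k → ⟦ n k ⟧ + 1# ≡ 0#
      ⟦n⟧+1≡0 zero    = x+1≡0
      ⟦n⟧+1≡0 (suc i) = begin
        ⟦ n (suc i) ⟧ + 1#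
          ≡⟨ +-identityˡ (⟦ n (suc i) ⟧ + 1#) ⟨
        0# + (⟦ n (suc i) ⟧ + 1#)
          ≡⟨ cong (_+ (⟦ n (suc i) ⟧ + 1#)) (trans (cong (_* α i) x+1≡0) (zeroˡ (α i))) ⟨
        (x + 1#) * α i + (⟦ n (suc i) ⟧ + 1#)
          ≡⟨ solve 3 (λ x a m → (x :+ con 1) :* a :+ (m :+ con 1) := x :* a :+ m :+ (con 1 :+ a))
                     refl x (α i) ⟦ n (suc i) ⟧ ⟩
        coords n i + (1# + α i)
          ≡⟨ vanish i ⟩
        0#
          ∎

    -- hence every multiplicity is at least p - 1, and there are d + 1 of them,
    -- exceeding H - 1 in total
    unrepresentable-minus-one : S ≢ 1# → 1 ≤ d →
                                ¬ Representable (d ℕ.* (p ∸ 1) ∸ 1) (λ i → - (1# + α i))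
    unrepresentable-minus-one S≢1 1≤d (n , Σn≡H-1 , coords≡a) =
      ℕₚ.<⇒≱ H-1<[d+1][p-1] [d+1][p-1]≤H-1
      where
      open ℕₚ.≤-Reasoning
      H = d ℕ.* (p ∸ 1)

      ⟦n⟧+1≡0 = minus-one-multiplicities S≢1 1≤d n Σn≡H-1 coords≡a

      H-1<[d+1][p-1] : H ∸ 1 < suc d ℕ.* (p ∸ 1)
      H-1<[d+1][p-1] = ℕₚ.≤-<-trans (ℕₚ.m∸n≤m H 1) (ℕₚ.m<n+m H 1≤p-1)

      [d+1][p-1]≤H-1 : suc d ℕ.* (p ∸ 1) ≤ H ∸ 1
      [d+1][p-1]≤H-1 = begin
        suc d ℕ.* (p ∸ 1)             ≡⟨ Σℕ-const (suc d) (p ∸ 1) ⟨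
        Σℕ {suc d} (λ _ → p ∸ 1)      ≤⟨ Σℕ-mono (λ k → ⟦⟧+1≡0⇒≥ (n k) (⟦n⟧+1≡0 k)) ⟩
        Σℕ n                          ≡⟨ Σn≡H-1 ⟩
        H ∸ 1                         ∎


module Sumset (p : ℕ) .{{_ : NonZero p}} {d : ℕ} (e : Fin d → Vect p d) (α : Fin d → Fp p) where

  open Residues p
  open Multisets p α
  open import Algebra.Solver.Ring.NaturalCoefficients.Default commutativeSemiring
    using (solve; _:=_; _:+_; _:*_)

  A : Fin (suc d) → Vect p d
  A = theSet p e α

  sumset-coords : ∀ {h} (f : Fin h → Fin (suc d)) n → HasMultiplicities f n →
                  sumᵥ p h (λ j → A (f j)) ≗ linComb p (coords n) e
  sumset-coords {h} f n f-has-n k = begin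
    sumᵥ p h (λ j → A (f j)) k
      ≡⟨ sumᵥ-at h (λ j → A (f j)) k ⟩
    sum (λ j → A (f j) k)
      ≡⟨ f-has-n (λ b → A b k) ⟩
    ⟦ n zero ⟧ * linComb p α e k + E
      ≡⟨ cong (λ y → ⟦ n zero ⟧ * y + E) (linComb-at α e k) ⟩
    ⟦ n zero ⟧ * sum (λ i → α i * e i k) + E
      ≡⟨ cong (_+ E) (*-distribˡ-sum ⟦ n zero ⟧ (λ i → α i * e i k)) ⟩
    sum (λ i → ⟦ n zero ⟧ * (α i * e i k)) + E
      ≡⟨ ∑-distrib-+ (λ i → ⟦ n zero ⟧ * (α i * e i k)) (λ i → ⟦ n (suc i) ⟧ * e i k) ⟨
    sum (λ i → ⟦ n zero ⟧ * (α i * e i k) + ⟦ n (suc i) ⟧ * e i k)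
      ≡⟨ sum-cong-≗ (λ i → solve 4 (λ x a y v → x :* (a :* v) :+ y :* v := (x :* a :+ y) :* v)
                                   refl ⟦ n zero ⟧ (α i) ⟦ n (suc i) ⟧ (e i k)) ⟩
    sum (λ i → coords n i * e i k)
      ≡⟨ linComb-at (coords n) e k ⟨
    linComb p (coords n) e k
      ∎
    where
    open ≡-Reasoning
    E = sum (λ i → ⟦ n (suc i) ⟧ * e i k)

  covers⇔representable : LinIndep p e → ∀ h → Covers p h A ⇔ (∀ a → Representable h a)
  covers⇔representable indep h = mk⇔ representable covers
    where
    representable : Covers p h A → ∀ a → Representable h a
    representable cover a =
      let (f , Σf≗a·e) = cover (linComb p a e) in
      count f , count-total f ,
      linComb-injective indep
        (λ k → trans (sym (sumset-coords f (count f) (count-multiplicities f) k)) (Σf≗a·e k))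

    covers : (∀ a → Representable h a) → Covers p h A
    covers representable x =
      let (c , c·e≗x) = linComb-surjective indep x
          (n , Σn≡h , coords≗c) = representable c
      in subst (λ h → InSumset p h A x) Σn≡h
           (fromCounts n , λ k → trans (sumset-coords (fromCounts n) n (fromCounts-multiplicities n) k)
                                       (trans (linComb-cong e coords≗c k) (c·e≗x k)))


open import Data.Nat using (_*_)

lemma5p3 : (p : ℕ) .{{_ : NonZero p}} → Prime p → (d : ℕ) → 1 ≤ d →
    (e : Fin d → Vect p d) → LinIndep p e → (α : Fin d → Fp p) →
    (NiceBasis p (theSet p e α) ⇔ (¬ (sumₚ p d α ≡ 1ₚ p)))
    × (¬ (sumₚ p d α ≡ 1ₚ p) →
         Covers p (d * (p ∸ 1)) (theSet p e α)
         × ¬ Covers p (d * (p ∸ 1) ∸ 1) (theSet p e α))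
lemma5p3 p isPrime d 1≤d e indep α =
  mk⇔ nice⇒S≢1 (λ S≢1 → d * (p ∸ 1) , 1≤d[p-1] 1≤d , covers S≢1) ,
  λ S≢1 → covers S≢1 , not-covers S≢1
  where
  open Residues p using (sumₚ≡sum)
  open Field p isPrime using (1≤d[p-1])
  open Multisets p α
  open Sumset p e α
  module Covers⇔ h = Equivalence (covers⇔representable indep h)

  S≡sum : sumₚ p d α ≡ S
  S≡sum = sumₚ≡sum d α

  nice⇒S≢1 : NiceBasis p A → ¬ (sumₚ p d α ≡ 1ₚ p)
  nice⇒S≢1 (h , _ , cover) S≡1 =
    let (a , ¬representable) = unrepresentable-if-S≡1 isPrime (trans (sym S≡sum) S≡1) 1≤d h
    in ¬representable (Covers⇔.to h cover a)

  covers : ¬ (sumₚ p d α ≡ 1ₚ p) → Covers p (d * (p ∸ 1)) A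
  covers S≢1 = Covers⇔.from _ (representable-if-S≢1 isPrime (S≢1 ∘ trans S≡sum))

  not-covers : ¬ (sumₚ p d α ≡ 1ₚ p) → ¬ Covers p (d * (p ∸ 1) ∸ 1) A
  not-covers S≢1 cover =
    unrepresentable-minus-one isPrime (S≢1 ∘ trans S≡sum) 1≤d (Covers⇔.to _ cover _)
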